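{- Let $N\ge2$ and let $(x_n)_{n\ge1}$ be the integer sequence given by $x_1=\cdots=x_N=1$ and $x_nx_{n+N}=x_{n+1}x_{n+N-1}+1$ for $n\ge1$. (a) Suppose $N=2r-1$ is odd. For $m\ge0$ let $a_m=x_{(N-1)m+r}$. Choose $1\le t\le N-1$ and let $b_m=x_{(N-1)m+t+1}-x_{(N-1)m+t}$. Then the pairs $(a_m,b_m)$, $m>0$, are exactly the positive integer solutions $(a,b)$ of the Pell equation $a^2-(r^2-1)b^2=1$. (b) Suppose $N=2r$ is even. Choose $t,t'$ with $1\le t\le r$ and $1\le t'\le N-1$. For $m\ge0$ let $a_m=x_{(N-1)m+t}+x_{(N-1)m+N+1-t}$ and $b_m=x_{(N-1)m+t'+1}-x_{(N-1)m+t'}$. Then the pairs $(a_m,b_m)$, $m>0$, are exactly the positive integer solutions $(a,b)$ of $a^2-((2r+1)^2-4)b^2=4$. -}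

module Defs where

open import Data.Nat using (ℕ; suc; _≤_; _∸_) renaming (_+_ to _+ℕ_)
open import Data.Integer using (ℤ; _+_; _-_; _*_; _<_; 0ℤ; 1ℤ)
open import Data.Product using (_×_; ∃-syntax)
open import Relation.Binary.PropositionalEquality using (_≡_)

-- x : ℕ → ℤ is the sequence (x_n)_{n ≥ 1} of the paper (the value at 0 is unused):
-- x_1 = ... = x_N = 1 and x_n x_{n+N} = x_{n+1} x_{n+N-1} + 1 for n ≥ 1.
IsRecSeq : ℕ → (ℕ → ℤ) → Set
IsRecSeq N x =
  (∀ i → 1 ≤ i → i ≤ N → x i ≡ 1ℤ) ×
  (∀ n → 1 ≤ n → x n * x (n +ℕ N) ≡ x (suc n) * x (n +ℕ N ∸ 1) + 1ℤ)

ExactlyPositiveSolutions : (ℕ → ℤ) → (ℕ → ℤ) → ℤ → ℤ → Set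
ExactlyPositiveSolutions A B D c =
  (∀ m → 1 ≤ m → (0ℤ < A m) × (0ℤ < B m) × (A m * A m - D * (B m * B m) ≡ c)) ×
  (∀ a b → 0ℤ < a → 0ℤ < b → a * a - D * (b * b) ≡ c →
     ∃[ m ] ((1 ≤ m) × (a ≡ A m) × (b ≡ B m)))

module Submission where

-- With p = N − 1, the sequence is an arithmetic progression U m, U m + Δ m, …, U m + p Δ m on
-- each window of indices pm + 1, …, pm + N, and consecutive windows share an endpoint; the
-- recurrence across two windows amounts to U m² + p U m Δ m − p Δ m² = 1. The pairs (U m, Δ m)
-- arise from (1, 0) by (u, d) ↦ (u + p d, u + p d + d), which preserves this conic, and the
-- inverse map descends from every natural point of the conic back to (1, 0), so the (U m, Δ m)
-- are all of them. The Pell equations are the conic rewritten through a = u + s d when p = 2s,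
-- and through a = 2u + p d in general.

open import Data.Nat using (ℕ)

module ℕ-Pell where
  open import Data.Nat
  open import Data.Nat.Properties
  open import Data.Nat.Divisibility using (_∣_; divides; ∣-trans; ∣m+n∣m⇒∣n; m∣m*n)
  open import Data.Nat.Induction using (<-rec)
  open import Data.Nat.Primality using (euclidsLemma; prime[2])
  open import Data.Nat.Tactic.RingSolver using (solve-∀)
  open import Data.Product using (_×_; _,_; ∃-syntax)
  open import Data.Sum using ([_,_]′)
  open import Function using (id)
  open import Relation.Nullary using (yes; no)
  open import Relation.Nullary.Negation using (contradiction)
  open import Relation.Binary.PropositionalEquality

  EnumeratesPellSolutions : (a b : ℕ → ℕ) (D c : ℕ) → Set
  EnumeratesPellSolutions a b D c =
    (∀ m → 1 ≤ m → 1 ≤ b m × a m * a m ≡ c + D * (b m * b m)) ×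
    (∀ α β → 1 ≤ β → α * α ≡ c + D * (β * β) → ∃[ m ] (1 ≤ m × α ≡ a m × β ≡ b m))

  *-self-cancel-< : ∀ {m n} → m * m < n * n → m < n
  *-self-cancel-< {m} {n} m²<n² with m <? n
  ... | yes m<n = m<n
  ... | no m≮n = contradiction (*-mono-≤ n≤m n≤m) (<⇒≱ m²<n²)
    where n≤m = ≮⇒≥ m≮n

  module Conic (p : ℕ) where

    OnConic : ℕ → ℕ → Set
    OnConic u d = u * u + p * u * d ≡ 1 + p * d * d

    -- U m and Δ m are the first term and the common difference of the arithmetic
    -- progression x_{pm+1}, …, x_{pm+p+1} (see x-block below).
    mutual
      U : ℕ → ℕ
      U zero    = 1
      U (suc m) = U m + p * Δ m

      Δ : ℕ → ℕ
      Δ zero    = 0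
      Δ (suc m) = U (suc m) + Δ m

    onConic-1-0 : OnConic 1 0
    onConic-1-0 rewrite *-zeroʳ (p * 1) | *-zeroʳ (p * 0) = refl

    onConic-next : ∀ {u d} → OnConic u d → OnConic (u + p * d) (u + p * d + d)
    onConic-next {u} {d} conic = +-cancelʳ-≡ (p * d * d) _ _ (begin
      v * v + p * v * (v + d) + p * d * d         ≡⟨ invariance p u d ⟩
      (u * u + p * u * d) + p * (v + d) * (v + d) ≡⟨ cong (_+ p * (v + d) * (v + d)) conic ⟩
      1 + p * d * d + p * (v + d) * (v + d)       ≡⟨ swap (p * d * d) (p * (v + d) * (v + d)) ⟩
      1 + p * (v + d) * (v + d) + p * d * d       ∎)
      where
      open ≡-Reasoning
      v = u + p * d
      invariance : ∀ q u d → (u + q * d) * (u + q * d) + q * (u + q * d) * ((u + q * d) + d) + q * d * d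
                             ≡ (u * u + q * u * d) + q * ((u + q * d) + d) * ((u + q * d) + d)
      invariance = solve-∀
      swap : ∀ a b → 1 + a + b ≡ 1 + b + a
      swap = solve-∀

    onConic-U-Δ : ∀ m → OnConic (U m) (Δ m)
    onConic-U-Δ zero    = onConic-1-0
    onConic-U-Δ (suc m) = onConic-next (onConic-U-Δ m)

    onConic⇒1≤u : ∀ {u d} → OnConic u d → 1 ≤ u
    onConic⇒1≤u {zero} {d} conic with () ← trans (cong (_* d) (sym (*-zeroʳ p))) conic
    onConic⇒1≤u {suc u} _ = s≤s z≤n

    onConic⇒u≡1 : ∀ {u} → OnConic u 0 → u ≡ 1
    onConic⇒u≡1 {u} conic = m*n≡1⇒m≡1 u u (begin
      u * u             ≡⟨ +-identityʳ (u * u) ⟨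
      u * u + 0         ≡⟨ cong (u * u +_) (*-zeroʳ (p * u)) ⟨
      u * u + p * u * 0 ≡⟨ conic ⟩
      1 + p * 0 * 0     ≡⟨ cong (1 +_) (*-zeroʳ (p * 0)) ⟩
      1                 ∎)
      where open ≡-Reasoning

    onConic⇒u≤d : ∀ {u d} → 1 ≤ d → OnConic u d → u ≤ d
    onConic⇒u≤d {u} {d} 1≤d conic with u ≤? d
    ... | yes u≤d = u≤d
    ... | no u≰d = contradiction (sym conic) (<⇒≢ (+-mono-<-≤ 1<u*u pdd≤pud))
      where
      d<u = ≰⇒> u≰d
      1<u*u : 1 < u * u
      1<u*u = ≤-trans (s≤s (s≤s z≤n)) (*-mono-≤ (≤-trans (s≤s 1≤d) d<u) (≤-trans (s≤s z≤n) d<u))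
      pdd≤pud : p * d * d ≤ p * u * d
      pdd≤pud = *-monoˡ-≤ d (*-monoʳ-≤ p (<⇒≤ d<u))

    onConic-previous : ∀ {u e} → OnConic u (u + e) → ∃[ u₀ ] (u ≡ u₀ + p * e × OnConic u₀ e)
    onConic-previous {u} {e} conic = u ∸ p * e , sym u₀+pe≡u , onConic-u₀
      where
      u² : u * u ≡ 1 + p * e * (u + e)
      u² = +-cancelʳ-≡ (p * u * (u + e)) _ _ (trans conic (expand p u e))
        where
        expand : ∀ q u e → 1 + q * (u + e) * (u + e) ≡ 1 + q * e * (u + e) + q * u * (u + e)
        expand = solve-∀
      pe<u : p * e < u
      pe<u = *-cancelʳ-< u (p * e) u (begin-strict
        p * e * u           ≤⟨ *-monoʳ-≤ (p * e) (m≤m+n u e) ⟩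
        p * e * (u + e)     <⟨ n<1+n _ ⟩
        1 + p * e * (u + e) ≡⟨ u² ⟨
        u * u               ∎)
        where open ≤-Reasoning
      u₀+pe≡u : u ∸ p * e + p * e ≡ u
      u₀+pe≡u = m∸n+n≡m (<⇒≤ pe<u)
      onConic-u₀ : OnConic (u ∸ p * e) e
      onConic-u₀ = square⇒onConic (subst (λ z → z * z ≡ 1 + p * e * (z + e)) (sym u₀+pe≡u) u²)
        where
        square⇒onConic : ∀ {u₀} → (u₀ + p * e) * (u₀ + p * e) ≡ 1 + p * e * (u₀ + p * e + e) → OnConic u₀ e
        square⇒onConic {u₀} eq = +-cancelʳ-≡ (p * e * u₀ + p * e * (p * e)) _ _
          (trans (sym (expandˡ p u₀ e)) (trans eq (expandʳ p u₀ e)))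
          where
          expandˡ : ∀ q u₀ e → (u₀ + q * e) * (u₀ + q * e) ≡ u₀ * u₀ + q * u₀ * e + (q * e * u₀ + q * e * (q * e))
          expandˡ = solve-∀
          expandʳ : ∀ q u₀ e → 1 + q * e * (u₀ + q * e + e) ≡ 1 + q * e * e + (q * e * u₀ + q * e * (q * e))
          expandʳ = solve-∀

    onConic⇒U-Δ : ∀ {u d} → OnConic u d → ∃[ m ] (u ≡ U m × d ≡ Δ m)
    onConic⇒U-Δ {u} {d} = <-rec P descend d u
      where
      P : ℕ → Set
      P d = ∀ u → OnConic u d → ∃[ m ] (u ≡ U m × d ≡ Δ m)
      descend : ∀ d → (∀ {e} → e < d → P e) → P d
      descend zero          _  u conic = 0 , onConic⇒u≡1 conic , refl
      descend d@(suc _) rec u conic =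
        let u+e≡d                = m+[n∸m]≡n (onConic⇒u≤d (s≤s z≤n) conic)
            u₀ , u≡u₀+pe , conic₀ = onConic-previous (subst (OnConic u) (sym u+e≡d) conic)
            e<d                  = subst (d ∸ u <_) u+e≡d (m<n+m (d ∸ u) (onConic⇒1≤u conic))
            m , u₀≡U , e≡Δ       = rec e<d u₀ conic₀
            u≡U′                 = trans u≡u₀+pe (cong₂ (λ a b → a + p * b) u₀≡U e≡Δ)
        in suc m , u≡U′ , trans (sym u+e≡d) (cong₂ _+_ u≡U′ e≡Δ)

    U-positive : ∀ m → 1 ≤ U m
    U-positive m = onConic⇒1≤u (onConic-U-Δ m)

    Δ-positive : ∀ m → 1 ≤ Δ (suc m)
    Δ-positive m = ≤-trans (U-positive (suc m)) (m≤m+n _ _)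

    -- The minor U m · Δ (m+1) − Δ m · U (m+1) equals U m² + p U m Δ m − p Δ m² = 1,
    -- which is what the recurrence asks of two consecutive progressions.
    U-Δ-recurrence : ∀ m k → (U m + k * Δ m) * (U (suc m) + suc k * Δ (suc m))
                             ≡ (U m + suc k * Δ m) * (U (suc m) + k * Δ (suc m)) + 1
    U-Δ-recurrence m k = +-cancelʳ-≡ (p * Δ m * Δ m) _ _ (begin
      (u + k * d) * (v + suc k * (v + d)) + p * d * d
        ≡⟨ expand p u d k ⟩
      (u + suc k * d) * (v + k * (v + d)) + (u * u + p * u * d)
        ≡⟨ cong ((u + suc k * d) * (v + k * (v + d)) +_) (onConic-U-Δ m) ⟩
      (u + suc k * d) * (v + k * (v + d)) + (1 + p * d * d)
        ≡⟨ +-assoc _ 1 _ ⟨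
      (u + suc k * d) * (v + k * (v + d)) + 1 + p * d * d ∎)
      where
      open ≡-Reasoning
      u = U m
      d = Δ m
      v = U (suc m)
      expand : ∀ q u d k → (u + k * d) * ((u + q * d) + suc k * ((u + q * d) + d)) + q * d * d
                           ≡ (u + suc k * d) * ((u + q * d) + k * ((u + q * d) + d)) + (u * u + q * u * d)
      expand = solve-∀

    onConic⇒U-Δ⁺ : ∀ {u d} → 1 ≤ d → OnConic u d → ∃[ m ] (1 ≤ m × u ≡ U m × d ≡ Δ m)
    onConic⇒U-Δ⁺ 1≤d conic with onConic⇒U-Δ conic
    ... | zero  , _   , refl with () ← 1≤d
    ... | suc m , u≡U , d≡Δ = suc m , s≤s z≤n , u≡U , d≡Δ

    conic⇒enumeratesPellSolutions :
      ∀ (f : ℕ → ℕ → ℕ) D c →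
      (∀ {u d} → OnConic u d → f u d * f u d ≡ c + D * (d * d)) →
      (∀ {α β} → α * α ≡ c + D * (β * β) → ∃[ u ] (α ≡ f u β × OnConic u β)) →
      EnumeratesPellSolutions (λ m → f (U m) (Δ m)) Δ D c
    conic⇒enumeratesPellSolutions f D c conic⇒pell pell⇒conic =
      (λ { (suc m) _ → Δ-positive m , conic⇒pell (onConic-U-Δ (suc m)) }) ,
      λ α β 1≤β pell →
        let u , α≡fuβ , conic     = pell⇒conic pell
            m , 1≤m , u≡U , β≡Δ = onConic⇒U-Δ⁺ 1≤β conic
        in m , 1≤m , trans α≡fuβ (cong₂ f u≡U β≡Δ) , β≡Δ

  m*m≡1+n*n+o⇒∃[w]m≡w+n : ∀ m n {o} → m * m ≡ 1 + n * n + o → ∃[ w ] (m ≡ w + n)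
  m*m≡1+n*n+o⇒∃[w]m≡w+n m n {o} eq =
    m ∸ n , sym (m∸n+n≡m (<⇒≤ (*-self-cancel-< {n} {m} n*n<m*m)))
    where
    n*n<m*m : n * n < m * m
    n*n<m*m = subst (n * n <_) (sym eq) (s≤s (m≤m+n (n * n) o))

  pell-1-solutions : ∀ s → let open Conic (s + s) in
                     EnumeratesPellSolutions (λ m → U m + s * Δ m) Δ (s * (s + 2)) 1
  pell-1-solutions s =
    conic⇒enumeratesPellSolutions (λ u d → u + s * d) (s * (s + 2)) 1 conic⇒pell pell⇒conic
    where
    open Conic (s + s)
    expand : ∀ s u d → (u + s * d) * (u + s * d) ≡ u * u + (s + s) * u * d + s * d * (s * d)
    expand = solve-∀
    coefficient : ∀ s d → 1 + s * (s + 2) * (d * d) ≡ 1 + (s + s) * d * d + s * d * (s * d)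
    coefficient = solve-∀
    rearrange : ∀ s β → 1 + s * (s + 2) * (β * β) ≡ 1 + s * β * (s * β) + (s + s) * (β * β)
    rearrange = solve-∀
    conic⇒pell : ∀ {u d} → OnConic u d → (u + s * d) * (u + s * d) ≡ 1 + s * (s + 2) * (d * d)
    conic⇒pell {u} {d} conic =
      trans (expand s u d) (trans (cong (_+ s * d * (s * d)) conic) (sym (coefficient s d)))
    pell⇒conic : ∀ {α β} → α * α ≡ 1 + s * (s + 2) * (β * β) → ∃[ u ] (α ≡ u + s * β × OnConic u β)
    pell⇒conic {α} {β} pell with m*m≡1+n*n+o⇒∃[w]m≡w+n α (s * β) (trans pell (rearrange s β))
    ... | u , refl = u , refl ,
      +-cancelʳ-≡ (s * β * (s * β)) _ _ (trans (sym (expand s u β)) (trans pell (coefficient s β)))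

  -- Solutions of the norm-4 equation have α ≡ p β (mod 2), so α = 2u + p β.
  pell-4-solutions : ∀ p → let open Conic p in
                     EnumeratesPellSolutions (λ m → U m + U m + p * Δ m) Δ (p * (p + 4)) 4
  pell-4-solutions p =
    conic⇒enumeratesPellSolutions (λ u d → u + u + p * d) (p * (p + 4)) 4 conic⇒pell pell⇒conic
    where
    open Conic p
    conic⇒pell : ∀ {u d} → OnConic u d → (u + u + p * d) * (u + u + p * d) ≡ 4 + p * (p + 4) * (d * d)
    conic⇒pell {u} {d} conic =
      trans (expand p u d) (trans (cong (λ z → 4 * z + p * d * (p * d)) conic) (sym (coefficient p d)))
      where
      expand : ∀ p u d → (u + u + p * d) * (u + u + p * d) ≡ 4 * (u * u + p * u * d) + p * d * (p * d)
      expand = solve-∀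
      coefficient : ∀ p d → 4 + p * (p + 4) * (d * d) ≡ 4 * (1 + p * d * d) + p * d * (p * d)
      coefficient = solve-∀
    rearrange : ∀ p β → 4 + p * (p + 4) * (β * β) ≡ 1 + p * β * (p * β) + (3 + 4 * p * (β * β))
    rearrange = solve-∀
    even-part : ∀ {w β} → (w + p * β) * (w + p * β) ≡ 4 + p * (p + 4) * (β * β) →
                ∃[ u ] (w ≡ u + u × OnConic u β)
    even-part {w} {β} pell = halve 2∣w
      where
      w-equation : 2 * (p * w * β) + w * w ≡ 4 * (1 + p * β * β)
      w-equation = +-cancelʳ-≡ (p * β * (p * β)) _ _ (trans (expand p w β) (trans pell (coefficient p β)))
        where
        expand : ∀ p w β → 2 * (p * w * β) + w * w + p * β * (p * β) ≡ (w + p * β) * (w + p * β)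
        expand = solve-∀
        coefficient : ∀ p β → 4 + p * (p + 4) * (β * β) ≡ 4 * (1 + p * β * β) + p * β * (p * β)
        coefficient = solve-∀
      2∣w : 2 ∣ w
      2∣w = [ id , id ]′ (euclidsLemma w w prime[2] (∣m+n∣m⇒∣n {m = 2 * (p * w * β)}
              (subst (2 ∣_) (sym w-equation) (∣-trans (divides 2 refl) (m∣m*n (1 + p * β * β))))
              (m∣m*n (p * w * β))))
      double : ∀ u → u * 2 ≡ u + u
      double = solve-∀
      quadruple : ∀ p u β → 4 * (u * u + p * u * β) ≡ 2 * (p * (u * 2) * β) + u * 2 * (u * 2)
      quadruple = solve-∀
      -- The quotient is taken by matching, never by projection: normalising the quotient
      -- computed by euclidsLemma exhausts memory.
      halve : 2 ∣ w → ∃[ u ] (w ≡ u + u × OnConic u β)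
      halve (divides u w≡u*2) = u , trans w≡u*2 (double u) ,
        *-cancelˡ-≡ _ _ 4 (trans (quadruple p u β)
          (subst (λ z → 2 * (p * z * β) + z * z ≡ 4 * (1 + p * β * β)) w≡u*2 w-equation))
    pell⇒conic : ∀ {α β} → α * α ≡ 4 + p * (p + 4) * (β * β) → ∃[ u ] (α ≡ u + u + p * β × OnConic u β)
    pell⇒conic {α} {β} pell with m*m≡1+n*n+o⇒∃[w]m≡w+n α (p * β) (trans pell (rearrange p β))
    ... | w , refl = let u , w≡u+u , conic = even-part {w} pell in u , cong (_+ p * β) w≡u+u , conic

open import Defs
open import Data.Nat using (ℕ; _≤_; _∸_) renaming (_+_ to _+ℕ_; _*_ to _*ℕ_)
open import Data.Integer using (ℤ; _+_; _-_; _*_; +_)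
open import Data.Product using (_×_)
open import Relation.Binary.PropositionalEquality using (_≡_)

open import Data.Nat using (zero; suc; z≤n; s≤s; >-nonZero)
import Data.Nat.Properties as ℕ
open import Data.Nat.Tactic.RingSolver using (solve-∀)
open import Data.Integer using (-[1+_]; 0ℤ; 1ℤ; _<_; +<+)
open import Data.Integer.Properties
  using (pos-+; pos-*; +-injective; *-cancelˡ-≡; [+m]-[+n]≡m⊖n; ⊖-≥)
import Data.Integer.Tactic.RingSolver as ℤ
open import Data.Product using (_,_; proj₁; proj₂; ∃-syntax)
open import Relation.Binary.PropositionalEquality
  using (refl; sym; trans; cong; cong₂; subst; module ≡-Reasoning)
open ℕ-Pell

m≡k+n⇒+m-+n≡+k : ∀ {m n k} → m ≡ k +ℕ n → + m - + n ≡ + k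
m≡k+n⇒+m-+n≡+k {n = n} {k} refl =
  trans ([+m]-[+n]≡m⊖n (k +ℕ n) n) (trans (⊖-≥ (ℕ.m≤n+m n k)) (cong +_ (ℕ.m+n∸n≡m k n)))

+m-+n≡+k⇒m≡k+n : ∀ {m n k} → + m - + n ≡ + k → m ≡ k +ℕ n
+m-+n≡+k⇒m≡k+n {m} {n} {k} eq = +-injective (begin
  + m                 ≡⟨ minus-plus (+ m) (+ n) ⟩
  + m - + n + + n     ≡⟨ cong (_+ + n) eq ⟩
  + k + + n           ≡⟨ pos-+ k n ⟨
  + (k +ℕ n)          ∎)
  where
  open ≡-Reasoning
  minus-plus : ∀ i j → i ≡ i - j + j
  minus-plus = ℤ.solve-∀

enumeratesPellSolutions⇒exactlyPositiveSolutions :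
  ∀ {A B : ℕ → ℤ} {a b : ℕ → ℕ} {D′ : ℤ} D c → 1 ≤ c →
  (∀ m → A m ≡ + a m) → (∀ m → B m ≡ + b m) → D′ ≡ + D →
  EnumeratesPellSolutions a b D c → ExactlyPositiveSolutions A B D′ (+ c)
enumeratesPellSolutions⇒exactlyPositiveSolutions {A} {B} {a} {b} D c (s≤s z≤n) A≡a B≡b refl
  (sound , complete) = sound′ , complete′
  where
  pell-ℤ≡ℕ : ∀ α β → + α * + α - + D * (+ β * + β) ≡ + (α *ℕ α) - + (D *ℕ (β *ℕ β))
  pell-ℤ≡ℕ α β =
    cong₂ _-_ (sym (pos-* α α)) (trans (cong (+ D *_) (sym (pos-* β β))) (sym (pos-* D (β *ℕ β))))
  positive : ∀ {α γ} → α *ℕ α ≡ c +ℕ γ → 0ℤ < + α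
  positive {zero} ()
  positive {suc α} _ = +<+ (s≤s z≤n)
  sound′ : ∀ m → 1 ≤ m → (0ℤ < A m) × (0ℤ < B m) × (A m * A m - + D * (B m * B m) ≡ + c)
  sound′ m 1≤m =
    let 1≤b , pell = sound m 1≤m
    in subst (0ℤ <_) (sym (A≡a m)) (positive pell) ,
       subst (0ℤ <_) (sym (B≡b m)) (+<+ 1≤b) ,
       trans (cong₂ (λ α β → α * α - + D * (β * β)) (A≡a m) (B≡b m))
             (trans (pell-ℤ≡ℕ (a m) (b m)) (m≡k+n⇒+m-+n≡+k pell))
  complete′ : ∀ α β → 0ℤ < α → 0ℤ < β → α * α - + D * (β * β) ≡ + c →
              ∃[ m ] ((1 ≤ m) × (α ≡ A m) × (β ≡ B m))
  complete′ (+ α) (+ β) _ (+<+ 1≤β) pell =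
    let m , 1≤m , α≡a , β≡b = complete α β 1≤β (+m-+n≡+k⇒m≡k+n (trans (sym (pell-ℤ≡ℕ α β)) pell))
    in m , 1≤m , trans (cong +_ α≡a) (sym (A≡a m)) , trans (cong +_ β≡b) (sym (B≡b m))
  complete′ -[1+ _ ] _        ()  _ _
  complete′ (+ _)    -[1+ _ ] _   () _

module RecurrenceBlocks (p : ℕ) {x : ℕ → ℤ} (recSeq : IsRecSeq (suc p) x) where
  open Conic p
  open ≡-Reasoning

  x-block-next : ∀ m → (∀ j → j ≤ p → x (p *ℕ m +ℕ suc j) ≡ + (U m +ℕ j *ℕ Δ m)) →
                 ∀ j → j ≤ p → x (p *ℕ suc m +ℕ suc j) ≡ + (U (suc m) +ℕ j *ℕ Δ (suc m))
  x-block-next m x-block-m zero _ = begin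
    x (p *ℕ suc m +ℕ 1)  ≡⟨ cong x (block-endpoint p m) ⟩
    x (p *ℕ m +ℕ suc p)  ≡⟨ x-block-m p ℕ.≤-refl ⟩
    + (U (suc m))        ≡⟨ cong +_ (ℕ.+-identityʳ (U (suc m))) ⟨
    + (U (suc m) +ℕ 0)   ∎
    where
    block-endpoint : ∀ p m → p *ℕ suc m +ℕ 1 ≡ p *ℕ m +ℕ suc p
    block-endpoint = solve-∀
  x-block-next m x-block-m (suc k) 1+k≤p = *-cancelˡ-≡ (+ a) _ (+ e) {{a≢0}} (begin
    + a * x (p *ℕ suc m +ℕ suc (suc k))     ≡⟨ cong₂ _*_ (x-block-m k k≤p) (cong x (n+N-in-next-block p m k)) ⟨
    x n * x (n +ℕ suc p)                    ≡⟨ proj₂ recSeq n 1≤n ⟩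
    x (suc n) * x (n +ℕ suc p ∸ 1) + 1ℤ     ≡⟨ cong₂ (λ y z → y * z + 1ℤ) x[n+1] x[n+N-1] ⟩
    + b * + c + 1ℤ                          ≡⟨ cong (_+ 1ℤ) (pos-* b c) ⟨
    + (b *ℕ c +ℕ 1)                         ≡⟨ cong +_ (U-Δ-recurrence m k) ⟨
    + (a *ℕ e)                              ≡⟨ pos-* a e ⟩
    + a * + e                               ∎)
    where
    n = p *ℕ m +ℕ suc k
    a = U m +ℕ k *ℕ Δ m
    b = U m +ℕ suc k *ℕ Δ m
    c = U (suc m) +ℕ k *ℕ Δ (suc m)
    e = U (suc m) +ℕ suc k *ℕ Δ (suc m)
    k≤p = ℕ.≤-trans (ℕ.n≤1+n k) 1+k≤p
    1≤n = ℕ.≤-trans (s≤s z≤n) (ℕ.m≤n+m (suc k) (p *ℕ m))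
    a≢0 = >-nonZero (ℕ.≤-trans (U-positive m) (ℕ.m≤m+n _ _))
    n+N-in-next-block : ∀ p m k → p *ℕ m +ℕ suc k +ℕ suc p ≡ p *ℕ suc m +ℕ suc (suc k)
    n+N-in-next-block = solve-∀
    n+p-in-next-block : ∀ p m k → p *ℕ m +ℕ suc k +ℕ p ≡ p *ℕ suc m +ℕ suc k
    n+p-in-next-block = solve-∀
    x[n+1] : x (suc n) ≡ + b
    x[n+1] = trans (cong x (sym (ℕ.+-suc (p *ℕ m) (suc k)))) (x-block-m (suc k) 1+k≤p)
    x[n+N-1] : x (n +ℕ suc p ∸ 1) ≡ + c
    x[n+N-1] = trans (cong x (trans (cong (_∸ 1) (ℕ.+-suc n p)) (n+p-in-next-block p m k)))
                     (x-block-next m x-block-m k k≤p)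

  x-block : ∀ m j → j ≤ p → x (p *ℕ m +ℕ suc j) ≡ + (U m +ℕ j *ℕ Δ m)
  x-block zero j j≤p rewrite ℕ.*-zeroʳ p | ℕ.*-zeroʳ j = proj₁ recSeq (suc j) (s≤s z≤n) (s≤s j≤p)
  x-block (suc m) = x-block-next m (x-block m)

  x-block-difference : ∀ m {t} → 1 ≤ t → t ≤ p → x (p *ℕ m +ℕ t +ℕ 1) - x (p *ℕ m +ℕ t) ≡ + Δ m
  x-block-difference m {suc t} _ 1+t≤p = begin
    x (p *ℕ m +ℕ suc t +ℕ 1) - x (p *ℕ m +ℕ suc t)
      ≡⟨ cong₂ _-_ (trans (cong x (successor (p *ℕ m) t)) (x-block m (suc t) 1+t≤p))
                   (x-block m t (ℕ.≤-trans (ℕ.n≤1+n t) 1+t≤p)) ⟩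
    + (U m +ℕ suc t *ℕ Δ m) - + (U m +ℕ t *ℕ Δ m)
      ≡⟨ m≡k+n⇒+m-+n≡+k (difference (U m) t (Δ m)) ⟩
    + Δ m ∎
    where
    successor : ∀ a t → a +ℕ suc t +ℕ 1 ≡ a +ℕ suc (suc t)
    successor = solve-∀
    difference : ∀ u t d → u +ℕ suc t *ℕ d ≡ d +ℕ (u +ℕ t *ℕ d)
    difference = solve-∀

  -- Positions t and N + 1 − t of a progression have offsets t − 1 and p − (t − 1), which add up to p.
  x-block-mirror-sum : ∀ m {t} → 1 ≤ t → t ≤ suc p →
                       x (p *ℕ m +ℕ t) + x (p *ℕ m +ℕ suc p +ℕ 1 ∸ t) ≡ + (U m +ℕ U m +ℕ p *ℕ Δ m)
  x-block-mirror-sum m {suc t} _ (s≤s t≤p) = begin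
    x (p *ℕ m +ℕ suc t) + x (p *ℕ m +ℕ suc p +ℕ 1 ∸ suc t)
      ≡⟨ cong (λ i → x (p *ℕ m +ℕ suc t) + x i) mirror-index ⟩
    x (p *ℕ m +ℕ suc t) + x (p *ℕ m +ℕ suc w)
      ≡⟨ cong₂ _+_ (x-block m t t≤p) (x-block m w (ℕ.m∸n≤m p t)) ⟩
    + (U m +ℕ t *ℕ Δ m) + + (U m +ℕ w *ℕ Δ m)
      ≡⟨ pos-+ (U m +ℕ t *ℕ Δ m) (U m +ℕ w *ℕ Δ m) ⟨
    + (U m +ℕ t *ℕ Δ m +ℕ (U m +ℕ w *ℕ Δ m))
      ≡⟨ cong +_ (trans (sum (U m) (Δ m) w t) (cong (λ q → U m +ℕ U m +ℕ q *ℕ Δ m) w+t≡p)) ⟩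
    + (U m +ℕ U m +ℕ p *ℕ Δ m) ∎
    where
    w = p ∸ t
    w+t≡p : w +ℕ t ≡ p
    w+t≡p = ℕ.m∸n+n≡m t≤p
    reassociate : ∀ a w t → a +ℕ suc (w +ℕ t) +ℕ 1 ≡ a +ℕ suc w +ℕ suc t
    reassociate = solve-∀
    mirror-index : p *ℕ m +ℕ suc p +ℕ 1 ∸ suc t ≡ p *ℕ m +ℕ suc w
    mirror-index = begin
      p *ℕ m +ℕ suc p +ℕ 1 ∸ suc t        ≡⟨ cong (λ q → p *ℕ m +ℕ suc q +ℕ 1 ∸ suc t) w+t≡p ⟨
      p *ℕ m +ℕ suc (w +ℕ t) +ℕ 1 ∸ suc t ≡⟨ cong (_∸ suc t) (reassociate (p *ℕ m) w t) ⟩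
      p *ℕ m +ℕ suc w +ℕ suc t ∸ suc t    ≡⟨ ℕ.m+n∸n≡m _ (suc t) ⟩
      p *ℕ m +ℕ suc w                     ∎
    sum : ∀ u d w t → u +ℕ t *ℕ d +ℕ (u +ℕ w *ℕ d) ≡ u +ℕ u +ℕ (w +ℕ t) *ℕ d
    sum = solve-∀

pell-solutions-odd : ∀ p {x : ℕ → ℤ} → IsRecSeq (suc p) x →
  ∀ r t → suc p ≡ 2 *ℕ r ∸ 1 → 1 ≤ t → t ≤ p →
  ExactlyPositiveSolutions
    (λ m → x (p *ℕ m +ℕ r))
    (λ m → x (p *ℕ m +ℕ t +ℕ 1) - x (p *ℕ m +ℕ t))
    (+ (r *ℕ r) - + 1) (+ 1)
pell-solutions-odd p recSeq zero t ()
pell-solutions-odd p recSeq (suc s) t N≡2r-1 1≤t t≤p with half N≡2r-1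
  where
  half : suc p ≡ 2 *ℕ suc s ∸ 1 → p ≡ s +ℕ s
  half eq = ℕ.suc-injective (trans eq (cong (_∸ 1) (double s)))
    where
    double : ∀ s → 2 *ℕ suc s ≡ suc (suc (s +ℕ s))
    double = solve-∀
... | refl = enumeratesPellSolutions⇒exactlyPositiveSolutions (s *ℕ (s +ℕ 2)) 1 (s≤s z≤n)
  (λ m → x-block m s (ℕ.m≤m+n s s)) (λ m → x-block-difference m 1≤t t≤p)
  (m≡k+n⇒+m-+n≡+k (square s)) (pell-1-solutions s)
  where
  open RecurrenceBlocks (s +ℕ s) recSeq
  square : ∀ s → suc s *ℕ suc s ≡ s *ℕ (s +ℕ 2) +ℕ 1
  square = solve-∀

pell-solutions-even : ∀ p {x : ℕ → ℤ} → IsRecSeq (suc p) x →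
  ∀ r t t′ → suc p ≡ 2 *ℕ r → 1 ≤ t → t ≤ r → 1 ≤ t′ → t′ ≤ p →
  ExactlyPositiveSolutions
    (λ m → x (p *ℕ m +ℕ t) + x (p *ℕ m +ℕ suc p +ℕ 1 ∸ t))
    (λ m → x (p *ℕ m +ℕ t′ +ℕ 1) - x (p *ℕ m +ℕ t′))
    (+ ((2 *ℕ r +ℕ 1) *ℕ (2 *ℕ r +ℕ 1)) - + 4) (+ 4)
pell-solutions-even p recSeq r t t′ N≡2r 1≤t t≤r 1≤t′ t′≤p =
  enumeratesPellSolutions⇒exactlyPositiveSolutions (p *ℕ (p +ℕ 4)) 4 (s≤s z≤n)
  (λ m → x-block-mirror-sum m 1≤t t≤N) (λ m → x-block-difference m 1≤t′ t′≤p)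
  (m≡k+n⇒+m-+n≡+k coefficient) (pell-4-solutions p)
  where
  open RecurrenceBlocks p recSeq
  t≤N : t ≤ suc p
  t≤N = ℕ.≤-trans t≤r (subst (r ≤_) (sym N≡2r) (ℕ.m≤m+n r (1 *ℕ r)))
  coefficient : (2 *ℕ r +ℕ 1) *ℕ (2 *ℕ r +ℕ 1) ≡ p *ℕ (p +ℕ 4) +ℕ 4
  coefficient = trans (cong (λ q → (q +ℕ 1) *ℕ (q +ℕ 1)) (sym N≡2r)) (square p)
    where
    square : ∀ p → (suc p +ℕ 1) *ℕ (suc p +ℕ 1) ≡ p *ℕ (p +ℕ 4) +ℕ 4
    square = solve-∀

mainTheorem15 : (N : ℕ) → 2 ≤ N → (x : ℕ → ℤ) → IsRecSeq N x →
    (∀ r t → N ≡ 2 *ℕ r ∸ 1 → 1 ≤ t → t ≤ N ∸ 1 →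
      ExactlyPositiveSolutions
        (λ m → x ((N ∸ 1) *ℕ m +ℕ r))
        (λ m → x ((N ∸ 1) *ℕ m +ℕ t +ℕ 1) - x ((N ∸ 1) *ℕ m +ℕ t))
        (+ (r *ℕ r) - + 1) (+ 1))
    ×
    (∀ r t t′ → N ≡ 2 *ℕ r → 1 ≤ t → t ≤ r → 1 ≤ t′ → t′ ≤ N ∸ 1 →
      ExactlyPositiveSolutions
        (λ m → x ((N ∸ 1) *ℕ m +ℕ t) + x ((N ∸ 1) *ℕ m +ℕ N +ℕ 1 ∸ t))
        (λ m → x ((N ∸ 1) *ℕ m +ℕ t′ +ℕ 1) - x ((N ∸ 1) *ℕ m +ℕ t′))
        (+ ((2 *ℕ r +ℕ 1) *ℕ (2 *ℕ r +ℕ 1)) - + 4) (+ 4))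
mainTheorem15 (suc zero) (s≤s ()) _ _
mainTheorem15 (suc (suc k)) _ x recSeq =
  pell-solutions-odd (suc k) recSeq , pell-solutions-even (suc k) recSeq
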